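{- Let $r\in\mathbb{N}\cup\{\infty\}$ and $k\in\mathbb{N}$. For every graph $G$ and every induced subgraph $H$ of $G$, $\mathrm{frk}_{r,k}(H)\le\mathrm{frk}_{r,k}(G)$.
   Context: Graphs are finite, simple, undirected. $B^r_H(v)$ is the set of vertices at distance at most $r$ from $v$ in $H$; $H[X]$ is the induced subgraph. Flipping $(A,B)$ in $G$ yields the graph on $V(G)$ with edge set (on distinct pairs) $E(G)\triangle\{ab:a\in A,b\in B\}$. A $k$-flip of $G$ is obtained by flipping some pairs $(A,B)$ with $A,B\in\mathcal{P}$ (possibly $A=B$) for a partition $\mathcal{P}$ of $V(G)$ with $|\mathcal{P}|\le k$. Flipper-rank: $\mathrm{frk}_{r,k}(K_1)=1$ and for every other graph $G$, $\mathrm{frk}_{r,k}(G)=1+\min_H\max_{v\in V(H)}\mathrm{frk}_{r,k}(H[B^r_H(v)])$, the minimum over all $k$-flips $H$ of $G$. -}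

module Defs where

open import Data.Nat using (ℕ; zero; suc)
open import Data.Fin using (Fin; _≟_)
open import Data.Bool using (Bool; true; false; _∧_; _∨_; _xor_; if_then_else_)
open import Data.Bool.Properties using (∧-comm; ∨-comm)
open import Data.Bool.ListAction using (any)
open import Data.List using (List; []; _∷_; foldr; allFin; filterᵇ; length; lookup)
open import Data.Product using (Σ; _×_; _,_)
open import Data.Sum using (_⊎_)
open import Data.Empty using (⊥; ⊥-elim)
open import Relation.Nullary using (yes; no)
open import Relation.Nullary.Decidable using (⌊_⌋)
open import Relation.Binary.PropositionalEquality using (_≡_; refl; sym; cong₂)
open import Function.Definitions using (Injective)

record Graph (n : ℕ) : Set where
  field
    adj    : Fin n → Fin n → Bool
    adj-sym    : ∀ u v → adj u v ≡ adj v u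
    adj-irrefl : ∀ v → adj v v ≡ false
open Graph public

inducedBy : ∀ {n m} → Graph n → (Fin m → Fin n) → Graph m
inducedBy G f = record
  { adj        = λ i j → adj G (f i) (f j)
  ; adj-sym    = λ i j → adj-sym G (f i) (f j)
  ; adj-irrefl = λ i → adj-irrefl G (f i)
  }

-- G[X] for a vertex set X ⊆ V(G) given by a Boolean predicate: the vertices of
-- X are enumerated (in increasing order, without repetition).
elems : ∀ {n} → (Fin n → Bool) → List (Fin n)
elems {n} X = filterᵇ X (allFin n)

induced : ∀ {n} (G : Graph n) (X : Fin n → Bool) → Graph (length (elems X))
induced G X = inducedBy G (lookup (elems X))

-- H is an induced subgraph of G (up to the naming of vertices):
-- there is an injective vertex map preserving adjacency and non-adjacency.
IsInducedSubgraph : ∀ {m n} → Graph m → Graph n → Set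
IsInducedSubgraph {m} {n} H G =
  Σ (Fin m → Fin n) λ f → Injective _≡_ _≡_ f × (∀ i j → adj H i j ≡ adj G (f i) (f j))

data Radius : Set where
  fin : ℕ → Radius
  ∞   : Radius

-- reach G s v u = true  iff  there is a walk of length ≤ s from v to u,
-- i.e. dist_G(v,u) ≤ s.
reach : ∀ {n} → Graph n → ℕ → Fin n → Fin n → Bool
reach G zero    v u = ⌊ u ≟ v ⌋
reach {n} G (suc s) v u = reach G s v u ∨ any (λ w → reach G s v w ∧ adj G w u) (allFin n)

-- Membership in B^r_G(v).  For r = ∞ we use distance ≤ n, which on an
-- n-vertex graph is the same as being at finite distance.
steps : ℕ → Radius → ℕ
steps n (fin r) = r
steps n ∞       = n

ball : ∀ {n} → Graph n → Radius → Fin n → Fin n → Bool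
ball {n} G r v = reach G (steps n r) v

ballGraph : ∀ {n} (H : Graph n) (r : Radius) (v : Fin n) → Graph (length (elems (ball H r v)))
ballGraph H r v = induced H (ball H r v)

-- A partition P of V(G) into at most k parts is given by a map
-- part : V(G) → Fin k (parts = nonempty fibres; empty fibres are harmless,
-- flipping with an empty part changes nothing).  The pairs (A,B) that are
-- flipped (A = B allowed, repetitions allowed) form a list of index pairs.

record Flip (k n : ℕ) : Set where
  field
    part  : Fin n → Fin k
    pairs : List (Fin k × Fin k)
open Flip public

hits : ∀ {k n} → (Fin n → Fin k) → Fin k × Fin k → Fin n → Fin n → Bool
hits p (i , j) u v = (⌊ p u ≟ i ⌋ ∧ ⌊ p v ≟ j ⌋) ∨ (⌊ p u ≟ j ⌋ ∧ ⌊ p v ≟ i ⌋)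

toggled : ∀ {k n} → (Fin n → Fin k) → List (Fin k × Fin k) → Fin n → Fin n → Bool
toggled p []       u v = false
toggled p (q ∷ qs) u v = hits p q u v xor toggled p qs u v

hits-sym : ∀ {k n} (p : Fin n → Fin k) q u v → hits p q u v ≡ hits p q v u
hits-sym p (i , j) u v
  rewrite ∧-comm ⌊ p u ≟ i ⌋ ⌊ p v ≟ j ⌋
        | ∧-comm ⌊ p u ≟ j ⌋ ⌊ p v ≟ i ⌋
        = ∨-comm (⌊ p v ≟ j ⌋ ∧ ⌊ p u ≟ i ⌋) (⌊ p v ≟ i ⌋ ∧ ⌊ p u ≟ j ⌋)

toggled-sym : ∀ {k n} (p : Fin n → Fin k) qs u v → toggled p qs u v ≡ toggled p qs v u
toggled-sym p []       u v = refl
toggled-sym p (q ∷ qs) u v = cong₂ _xor_ (hits-sym p q u v) (toggled-sym p qs u v)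

flipAdj : ∀ {k n} → Graph n → Flip k n → Fin n → Fin n → Bool
flipAdj G φ u v with u ≟ v
... | yes _ = false
... | no  _ = adj G u v xor toggled (part φ) (pairs φ) u v

flipAdj-sym : ∀ {k n} (G : Graph n) (φ : Flip k n) u v → flipAdj G φ u v ≡ flipAdj G φ v u
flipAdj-sym G φ u v with u ≟ v | v ≟ u
... | yes _ | yes _ = refl
... | yes e | no ne = ⊥-elim (ne (sym e))
... | no ne | yes e = ⊥-elim (ne (sym e))
... | no _  | no _  = cong₂ _xor_ (adj-sym G u v) (toggled-sym (part φ) (pairs φ) u v)

flipAdj-irrefl : ∀ {k n} (G : Graph n) (φ : Flip k n) v → flipAdj G φ v v ≡ false
flipAdj-irrefl G φ v with v ≟ v
... | yes _ = refl
... | no ne = ⊥-elim (ne refl)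

flip : ∀ {k n} → Graph n → Flip k n → Graph n
flip G φ = record
  { adj        = flipAdj G φ
  ; adj-sym    = flipAdj-sym G φ
  ; adj-irrefl = flipAdj-irrefl G φ
  }

-- Flipper-rank.  frk_{r,k}(G) ∈ ℕ ∪ {∞}; we define the relation
-- FrkLe r k t G  :⇔  frk_{r,k}(G) ≤ t, by recursion on t, following
--   frk(K₁) = 1,
--   frk(G)  = 1 + min_{H k-flip of G} max_{v} frk(H[B^r_H(v)])   (G ≠ K₁).

FrkLe : Radius → ℕ → ℕ → ∀ {n} → Graph n → Set
FrkLe r k zero    G = ⊥
FrkLe r k (suc t) {n} G =
  (n ≡ 1) ⊎ Σ (Flip k n) λ φ → ∀ v → FrkLe r k t (ballGraph (flip G φ) r v)

-- An embedding f of H into G as an induced subgraph transports a k-flip of G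
-- to one of H (pull the partition back along f, flip the same pairs), and f
-- stays an induced embedding of the flipped graphs.  Walks of H map to walks of
-- G, so f embeds every ball of the flipped H into the ball around the image
-- vertex in the flipped G, and induction on the rank bound finishes the proof.
-- Induced subgraphs of K₁ are K₁ itself and the empty graph, whose rank bound
-- holds vacuously since it has no balls.
module Submission where

open import Defs
open import Data.Nat using (ℕ; zero; suc; _≤_; z≤n; s≤s; _≤′_; ≤′-refl; ≤′-step)
open import Data.Nat.Properties using (≤⇒≤′)
open import Data.Fin using (Fin; _≟_)
open import Data.Fin.Properties using (injective⇒≤)
open import Data.Bool using (Bool; T; _xor_)
open import Data.Bool.Properties using (T-∧; T-∨)
open import Data.List using (List; []; _∷_; allFin; length; lookup)
open import Data.List.Relation.Unary.Any using (index; satisfied)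
open import Data.List.Relation.Unary.Any.Properties using (lookup-index; any⁺; any⁻)
import Data.List.Relation.Unary.All as All
open import Data.List.Relation.Unary.AllPairs using (_∷_)
open import Data.List.Relation.Unary.Unique.Propositional using (Unique)
open import Data.List.Relation.Unary.Unique.Propositional.Properties using (filter⁺; allFin⁺)
open import Data.List.Membership.Propositional using (lose)
open import Data.List.Membership.Propositional.Properties
  using (∈-filter⁺; ∈-filter⁻; ∈-lookup; ∈-allFin)
open import Data.Product using (Σ; _,_; proj₁; proj₂)
open import Data.Sum using (inj₁; inj₂)
open import Data.Empty using (⊥-elim)
open import Relation.Nullary using (yes; no)
open import Relation.Nullary.Decidable using (T?; toWitness; fromWitness)
open import Relation.Binary.PropositionalEquality using (_≡_; refl; sym; trans; cong; cong₂; subst)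
open import Function.Definitions using (Injective)
open import Function.Bundles using (Equivalence)
open import Function using (_∘_)

open Equivalence using (to; from)

lookup-injective : ∀ {A : Set} {xs : List A} → Unique xs → Injective _≡_ _≡_ (lookup xs)
lookup-injective (_ ∷ _)    {Fin.zero}  {Fin.zero}  _ = refl
lookup-injective (x∉xs ∷ _) {Fin.zero}  {Fin.suc j} e = ⊥-elim (All.lookup x∉xs (∈-lookup j) e)
lookup-injective (x∉xs ∷ _) {Fin.suc i} {Fin.zero}  e = ⊥-elim (All.lookup x∉xs (∈-lookup i) (sym e))
lookup-injective (_ ∷ u)    {Fin.suc i} {Fin.suc j} e = cong Fin.suc (lookup-injective u e)

elems-unique : ∀ {n} (X : Fin n → Bool) → Unique (elems X)
elems-unique {n} X = filter⁺ (T? ∘ X) (allFin⁺ n)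

elems⁺ : ∀ {n} (X : Fin n → Bool) {u} → T (X u) → Σ (Fin (length (elems X))) λ i → lookup (elems X) i ≡ u
elems⁺ X {u} Xu = index u∈X , sym (lookup-index u∈X)
  where u∈X = ∈-filter⁺ (T? ∘ X) (∈-allFin u) Xu

elems⁻ : ∀ {n} (X : Fin n → Bool) i → T (X (lookup (elems X) i))
elems⁻ {n} X i = proj₂ (∈-filter⁻ (T? ∘ X) {xs = allFin n} (∈-lookup i))

induced-mono : ∀ {m n} (H : Graph m) (G : Graph n) → ((f , _ , _) : IsInducedSubgraph H G) →
  (X : Fin m → Bool) (Y : Fin n → Bool) → (∀ u → T (X u) → T (Y (f u))) →
  IsInducedSubgraph (induced H X) (induced G Y)
induced-mono H G (f , f-inj , f-adj) X Y X⊆Y = g , g-inj , g-adj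
  where
    image : ∀ i → Σ (Fin (length (elems Y))) λ j → lookup (elems Y) j ≡ f (lookup (elems X) i)
    image i = elems⁺ Y (X⊆Y _ (elems⁻ X i))

    g = proj₁ ∘ image

    g-inj : Injective _≡_ _≡_ g
    g-inj {i} {j} gi≡gj = lookup-injective (elems-unique X)
      (f-inj (trans (sym (proj₂ (image i))) (trans (cong (lookup (elems Y)) gi≡gj) (proj₂ (image j)))))

    g-adj : ∀ i j → adj (induced H X) i j ≡ adj (induced G Y) (g i) (g j)
    g-adj i j = trans (f-adj _ _) (sym (cong₂ (adj G) (proj₂ (image i)) (proj₂ (image j))))

reach-suc : ∀ {n} (G : Graph n) s v u → T (reach G s v u) → T (reach G (suc s) v u)
reach-suc G s v u h = from T-∨ (inj₁ h)

reach-mono : ∀ {n} (G : Graph n) {s s′} → s ≤′ s′ → ∀ v u → T (reach G s v u) → T (reach G s′ v u)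
reach-mono G ≤′-refl v u h = h
reach-mono G {s′ = suc s′} (≤′-step s≤′s′) v u h = reach-suc G s′ v u (reach-mono G s≤′s′ v u h)

reach-map : ∀ {m n} (H : Graph m) (G : Graph n) (f : Fin m → Fin n) →
  (∀ i j → adj H i j ≡ adj G (f i) (f j)) →
  ∀ s v u → T (reach H s v u) → T (reach G s (f v) (f u))
reach-map H G f f-adj zero v u h = fromWitness (cong f (toWitness h))
reach-map {m} H G f f-adj (suc s) v u h with to T-∨ h
... | inj₁ near = reach-suc G s (f v) (f u) (reach-map H G f f-adj s v u near)
... | inj₂ step with satisfied (any⁻ _ (allFin m) step)
...   | w , reach-w-adj with to T-∧ reach-w-adj
...     | v⇝w , w∼u = from T-∨ (inj₂ (any⁺ _ (lose (∈-allFin (f w))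
            (from T-∧ (reach-map H G f f-adj s v w v⇝w , subst T (f-adj w u) w∼u)))))

-- For r = ∞ the radius is the number of vertices, and m ≤ n since f is injective.
ball-map : ∀ {m n} (H : Graph m) (G : Graph n) → ((f , _ , _) : IsInducedSubgraph H G) →
  ∀ r v u → T (ball H r v u) → T (ball G r (f v) (f u))
ball-map H G (f , _ , f-adj) (fin s) v u = reach-map H G f f-adj s v u
ball-map {m} H G (f , f-inj , f-adj) ∞ v u h =
  reach-mono G (≤⇒≤′ (injective⇒≤ f-inj)) (f v) (f u) (reach-map H G f f-adj m v u h)

ballGraph-mono : ∀ {m n} (H : Graph m) (G : Graph n) → ((f , _ , _) : IsInducedSubgraph H G) →
  ∀ r v → IsInducedSubgraph (ballGraph H r v) (ballGraph G r (f v))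
ballGraph-mono H G I@(f , _ , _) r v =
  induced-mono H G I (ball H r v) (ball G r (f v)) (ball-map H G I r v)

pullbackFlip : ∀ {k m n} → Flip k n → (Fin m → Fin n) → Flip k m
pullbackFlip φ f = record { part = part φ ∘ f ; pairs = pairs φ }

toggled-∘ : ∀ {k m n} (p : Fin n → Fin k) (f : Fin m → Fin n) qs i j →
  toggled (p ∘ f) qs i j ≡ toggled p qs (f i) (f j)
toggled-∘ p f []       i j = refl
toggled-∘ p f (q ∷ qs) i j = cong (hits p q (f i) (f j) xor_) (toggled-∘ p f qs i j)

flip-mono : ∀ {k m n} (H : Graph m) (G : Graph n) → ((f , _ , _) : IsInducedSubgraph H G) →
  (φ : Flip k n) → IsInducedSubgraph (flip H (pullbackFlip φ f)) (flip G φ)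
flip-mono H G (f , f-inj , f-adj) φ = f , f-inj , flip-adj
  where
    flip-adj : ∀ i j → flipAdj H (pullbackFlip φ f) i j ≡ flipAdj G φ (f i) (f j)
    flip-adj i j with i ≟ j | f i ≟ f j
    ... | yes _   | yes _     = refl
    ... | yes i≡j | no fi≢fj  = ⊥-elim (fi≢fj (cong f i≡j))
    ... | no i≢j  | yes fi≡fj = ⊥-elim (i≢j (f-inj fi≡fj))
    ... | no _    | no _      = cong₂ _xor_ (f-adj i j) (toggled-∘ (part φ) f (pairs φ) i j)

frkLe-atMostOneVertex : ∀ r k t {m} (H : Graph m) → m ≤ 1 → FrkLe r k (suc t) H
frkLe-atMostOneVertex r k t H z≤n       = inj₂ (record { part = λ () ; pairs = [] } , λ ())
frkLe-atMostOneVertex r k t H (s≤s z≤n) = inj₁ refl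

lemma4p8 : (r : Radius) (k : ℕ) {n m : ℕ} (G : Graph n) (H : Graph m) →
    IsInducedSubgraph H G →
    ∀ t → FrkLe r k t G → FrkLe r k t H
lemma4p8 r k G H I zero ()
lemma4p8 r k G H (f , f-inj , _) (suc t) (inj₁ refl) = frkLe-atMostOneVertex r k t H (injective⇒≤ f-inj)
lemma4p8 r k G H I@(f , _ , _) (suc t) (inj₂ (φ , balls-frkLe)) =
  inj₂ (pullbackFlip φ f , λ v →
    lemma4p8 r k _ _ (ballGraph-mono _ _ (flip-mono H G I φ) r v) t (balls-frkLe (f v)))
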